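{- Let $p$ be a prime, $\alpha\geq 1$ an integer, and $\Gamma=\mathrm{Cay}(\mathbb{Z}_{p}\times\mathbb{Z}_{p^{\alpha}},\Phi)$ with $\Phi=\varphi_p\times\varphi_{p^\alpha}$. Then (1) if $p=2$, $\gamma_t(\Gamma)=4$ and $\Gamma$ has no connected dominating set; (2) if $p\geq 3$, $\gamma_t(\Gamma)=\gamma_c(\Gamma)=3$.
   Context: For $n\geq 1$, $\mathbb{Z}_n=\{0,\dots,n-1\}$ is the integers mod $n$ and $\varphi_n$ is the set of elements of $\mathbb{Z}_n$ coprime to $n$ ($\varphi_p=\mathbb{Z}_p\setminus\{0\}$ for $p$ prime). $\mathrm{Cay}(\mathbb{Z}_p\times\mathbb{Z}_m,\varphi_p\times\varphi_m)$ is the graph on $\mathbb{Z}_p\times\mathbb{Z}_m$ where $(u,v)\sim(u',v')$ iff $u-u'\in\varphi_p$ and $v-v'\in\varphi_m$. A total dominating set is a vertex set $T$ such that every vertex is adjacent to some vertex of $T$; $\gamma_t$ is the minimum size of one. A connected dominating set is a dominating set inducing a connected subgraph; $\gamma_c$ is the minimum size of one. -}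

module Defs where

open import Data.Nat using (ℕ; _+_; _∸_; _≤_; _≤ᵇ_)
open import Data.Nat.Coprimality using (Coprime)
open import Data.Fin using (Fin; toℕ)
open import Data.Bool using (if_then_else_)
open import Data.Product using (_×_; Σ; ∃; _,_)
open import Data.List using (List; length)
open import Data.List.Membership.Propositional using (_∈_)
open import Data.List.Relation.Unary.Unique.Propositional using (Unique)
open import Data.List.Relation.Unary.Any using (Any)
open import Data.Sum using (_⊎_)
open import Relation.Binary.PropositionalEquality using (_≡_)

diffMod : (n : ℕ) → Fin n → Fin n → ℕ
diffMod n u u' = if toℕ u' ≤ᵇ toℕ u then toℕ u ∸ toℕ u' else (n + toℕ u) ∸ toℕ u'

InPhi : ℕ → ℕ → Set
InPhi n x = Coprime x n

Vtx : ℕ → ℕ → Set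
Vtx m n = Fin m × Fin n

Adj : (m n : ℕ) → Vtx m n → Vtx m n → Set
Adj m n (u , v) (u' , v') = InPhi m (diffMod m u u') × InPhi n (diffMod n v v')

-- Generic graph notions for a graph given by a vertex type and adjacency.
-- Vertex sets are duplicate-free lists; their size is the length.

module Graph (V : Set) (E : V → V → Set) where

  IsTotalDominating : List V → Set
  IsTotalDominating T = ∀ x → Any (λ t → E x t) T

  IsDominating : List V → Set
  IsDominating T = ∀ x → x ∈ T ⊎ Any (λ t → E x t) T

  data WalkIn (T : List V) : V → V → Set where
    here : ∀ {x} → x ∈ T → WalkIn T x x
    step : ∀ {x y z} → x ∈ T → E x y → WalkIn T y z → WalkIn T x z

  InducesConnected : List V → Set
  InducesConnected T = ∀ {x y} → x ∈ T → y ∈ T → WalkIn T x y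

  IsConnectedDominating : List V → Set
  IsConnectedDominating T = IsDominating T × InducesConnected T

  TotalDominationNumberIs : ℕ → Set
  TotalDominationNumberIs k =
    (Σ (List V) λ T → Unique T × IsTotalDominating T × length T ≡ k)
    × (∀ T → Unique T → IsTotalDominating T → k ≤ length T)

  ConnectedDominationNumberIs : ℕ → Set
  ConnectedDominationNumberIs k =
    (Σ (List V) λ T → Unique T × IsConnectedDominating T × length T ≡ k)
    × (∀ T → Unique T → IsConnectedDominating T → k ≤ length T)

-- Adjacency only depends on the residues mod p of the two coordinates: (u , v) ~ (u' , v') iff
-- u ≢ u' and v ≢ v' (mod p), because p is the only prime dividing p and p ^ α. So Γ is a blow-up
-- of the tensor square of the complete graph Kₚ, and everything reduces to the residue classes.
-- For p ≥ 3 the three diagonal classes (i , i), i < 3, form a triangle dominating every class;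
-- two vertices never suffice because the class (r₁ x , r₂ y) sees neither x nor y.
-- For p = 2 the neighbours of a vertex all lie in the opposite class, so the four classes have
-- disjoint neighbourhoods and γₜ = 4; moreover adjacency preserves whether a vertex lies on the
-- diagonal r₁ ≡ r₂, so Γ is disconnected and has no connected dominating set.
module Submission where

open import Defs
open import Data.Bool using (Bool; true; false)
open import Data.Bool.Properties using (T-≡)
open import Data.Empty using (⊥; ⊥-elim)
open import Data.Fin using (Fin; toℕ; fromℕ<; #_) renaming (_≟_ to _≟ᶠ_)
open import Data.Fin.Properties using (toℕ<n; toℕ-fromℕ<; toℕ-injective; injective⇒≤)
open import Data.List using (List; []; _∷_; length; lookup; tabulate)
open import Data.List.Membership.Propositional using (_∈_; find; lose)
open import Data.List.Membership.Propositional.Properties using (∈-tabulate⁺; ∈-tabulate⁻)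
open import Data.List.Relation.Unary.Any using (here; there)
open import Data.List.Relation.Unary.Any.Properties using (lookup-index)
open import Data.List.Relation.Unary.AllPairs using (_∷_)
open import Data.List.Relation.Unary.Unique.Propositional using (Unique)
open import Data.List.Relation.Unary.Unique.Propositional.Properties using (tabulate⁺)
open import Data.List.Relation.Unary.All using ([]; _∷_)
open import Data.Nat
open import Data.Nat.Properties
open import Data.Nat.Divisibility
open import Data.Nat.DivMod
open import Data.Nat.Coprimality using (Coprime; coprime-divisor)
open import Data.Nat.Primality using (Prime; prime⇒nonZero; prime⇒nonTrivial; prime⇒irreducible)
open import Data.Product
open import Data.Product.Function.NonDependent.Propositional using (_×-⇔_)
open import Data.Sum using (_⊎_; inj₁; inj₂)
open import Function using (_∘_; _$_)
open import Function.Bundles using (_⇔_; mk⇔; Equivalence)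
open import Relation.Nullary using (¬_; yes; no)
open import Relation.Binary.PropositionalEquality

open Equivalence using (to; from)

%≡⇒∣∸ : ∀ p .{{_ : NonZero p}} {b c} → c % p ≡ b % p → p ∣ c ∸ b
%≡⇒∣∸ p {b} {c} c≡b = divides (c / p ∸ b / p) $ begin
  c ∸ b                                     ≡⟨ cong₂ _∸_ (m≡m%n+[m/n]*n c p) (m≡m%n+[m/n]*n b p) ⟩
  (c % p + c / p * p) ∸ (b % p + b / p * p) ≡⟨ cong (λ r → (r + c / p * p) ∸ (b % p + b / p * p)) c≡b ⟩
  (b % p + c / p * p) ∸ (b % p + b / p * p) ≡⟨ [m+n]∸[m+o]≡n∸o (b % p) _ _ ⟩
  c / p * p ∸ b / p * p                     ≡⟨ *-distribʳ-∸ p (c / p) (b / p) ⟨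
  (c / p ∸ b / p) * p                       ∎
  where open ≡-Reasoning

∣∸⇔%≡ : ∀ p .{{_ : NonZero p}} {b c} → b ≤ c → p ∣ c ∸ b ⇔ c % p ≡ b % p
∣∸⇔%≡ p {b} {c} b≤c = mk⇔ ∣∸⇒%≡ (%≡⇒∣∸ p)
  where
  open ≡-Reasoning
  ∣∸⇒%≡ : p ∣ c ∸ b → c % p ≡ b % p
  ∣∸⇒%≡ p∣c∸b = begin
    c % p             ≡⟨ %-congˡ (m+[n∸m]≡n b≤c) ⟨
    (b + (c ∸ b)) % p ≡⟨ %-remove-+ʳ b p∣c∸b ⟩
    b % p             ∎

∣diffMod⇔%≡ : ∀ {p n} .{{_ : NonZero p}} → p ∣ n → (u u' : Fin n) →
              p ∣ diffMod n u u' ⇔ toℕ u % p ≡ toℕ u' % p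
∣diffMod⇔%≡ {p} {n} p∣n u u' with toℕ u' ≤ᵇ toℕ u in u'≤ᵇu
... | true  = ∣∸⇔%≡ p (≤ᵇ⇒≤ _ _ (from T-≡ u'≤ᵇu))
... | false = mk⇔ (λ d → trans (sym wrap) (to wrapped d)) (λ e → from wrapped (trans wrap e))
  where
  wrapped : p ∣ (n + toℕ u) ∸ toℕ u' ⇔ (n + toℕ u) % p ≡ toℕ u' % p
  wrapped = ∣∸⇔%≡ p (≤-trans (<⇒≤ (toℕ<n u')) (m≤m+n n (toℕ u)))
  wrap : (n + toℕ u) % p ≡ toℕ u % p
  wrap = %-remove-+ˡ (toℕ u) p∣n

/∧%⇒≡ : ∀ {m o} n .{{_ : NonZero n}} → m / n ≡ o / n → m % n ≡ o % n → m ≡ o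
/∧%⇒≡ {m} {o} n m/n≡o/n m%n≡o%n = begin
  m                 ≡⟨ m≡m%n+[m/n]*n m n ⟩
  m % n + m / n * n ≡⟨ cong₂ (λ r q → r + q * n) m%n≡o%n m/n≡o/n ⟩
  o % n + o / n * n ≡⟨ m≡m%n+[m/n]*n o n ⟨
  o                 ∎
  where open ≡-Reasoning

≢⇒≡1∸ : ∀ {a c} → a < 2 → c < 2 → a ≢ c → a ≡ 1 ∸ c
≢⇒≡1∸ {0}           {0}           _               _               a≢c = ⊥-elim (a≢c refl)
≢⇒≡1∸ {0}           {1}           _               _               _   = refl
≢⇒≡1∸ {1}           {0}           _               _               _   = refl
≢⇒≡1∸ {1}           {1}           _               _               a≢c = ⊥-elim (a≢c refl)
≢⇒≡1∸ {suc (suc _)} {_}           (s≤s (s≤s ()))  _               _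
≢⇒≡1∸ {_}           {suc (suc _)} _               (s≤s (s≤s ()))  _

≡ᵇ-1∸ : ∀ {a b} → a < 2 → b < 2 → (1 ∸ a ≡ᵇ 1 ∸ b) ≡ (a ≡ᵇ b)
≡ᵇ-1∸ {0}           {0}           _              _              = refl
≡ᵇ-1∸ {0}           {1}           _              _              = refl
≡ᵇ-1∸ {1}           {0}           _              _              = refl
≡ᵇ-1∸ {1}           {1}           _              _              = refl
≡ᵇ-1∸ {suc (suc _)} {_}           (s≤s (s≤s ())) _
≡ᵇ-1∸ {_}           {suc (suc _)} _              (s≤s (s≤s ()))

m∣m^n : ∀ {m n} → n ≥ 1 → m ∣ m ^ n
m∣m^n {m} {suc n} _ = m∣m*n (m ^ n)

coprime-* : ∀ {a b c} → Coprime a b → Coprime a c → Coprime a (b * c)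
coprime-* a⊥b a⊥c {d} (d∣a , d∣bc) =
  a⊥c (d∣a , coprime-divisor (λ {e} (e∣d , e∣b) → a⊥b (∣-trans e∣d d∣a , e∣b)) d∣bc)

module _ {p} (p-prime : Prime p) where

  private instance
    p≢0 : NonZero p
    p≢0 = prime⇒nonZero p-prime

  ∤⇒coprime-^ : ∀ {x} → p ∤ x → ∀ k → Coprime x (p ^ k)
  ∤⇒coprime-^ p∤x zero    (_ , d∣1) = ∣1⇒≡1 d∣1
  ∤⇒coprime-^ p∤x (suc k)           = coprime-* x⊥p (∤⇒coprime-^ p∤x k)
    where
    x⊥p : Coprime _ p
    x⊥p {d} (d∣x , d∣p) with prime⇒irreducible p-prime d∣p
    ... | inj₁ d≡1 = d≡1
    ... | inj₂ refl = ⊥-elim (p∤x d∣x)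

  coprime⇒∤ : ∀ {n x} → p ∣ n → Coprime x n → p ∤ x
  coprime⇒∤ p∣n x⊥n p∣x = nonTrivial⇒≢1 {{prime⇒nonTrivial p-prime}} (x⊥n (p∣x , p∣n))

  ∤⇒coprime : ∀ {n k x} → n ∣ p ^ k → p ∤ x → Coprime x n
  ∤⇒coprime {k = k} n∣p^k p∤x (d∣x , d∣n) = ∤⇒coprime-^ p∤x k (d∣x , ∣-trans d∣n n∣p^k)

  inPhi-diffMod⇔ : ∀ {n k} → p ∣ n → n ∣ p ^ k → (u u' : Fin n) →
                   InPhi n (diffMod n u u') ⇔ toℕ u % p ≢ toℕ u' % p
  inPhi-diffMod⇔ {n} {k} p∣n n∣p^k u u' = mk⇔
    (λ (φ : InPhi n (diffMod n u u')) → coprime⇒∤ p∣n φ ∘ from (∣diffMod⇔%≡ p∣n u u'))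
    (λ u≢u' → ∤⇒coprime {k = k} n∣p^k (u≢u' ∘ to (∣diffMod⇔%≡ p∣n u u')))

module _ {V : Set} (E : V → V → Set) where
  open Graph V E

  walk-preserves : ∀ {A : Set} (f : V → A) → (∀ {x y} → E x y → f x ≡ f y) →
                   ∀ {T x y} → WalkIn T x y → f x ≡ f y
  walk-preserves f f-inv (here _)     = refl
  walk-preserves f f-inv (step _ e w) = trans (f-inv e) (walk-preserves f f-inv w)

  -- A dominating set meets every class of an invariant f, a connected one lies in a single class.
  connectedDominating⇒invariant-constant :
    ∀ {A : Set} (f : V → A) → (∀ {x y} → E x y → f x ≡ f y) →
    ∀ {T} → IsConnectedDominating T → ∀ x y → f x ≡ f y
  connectedDominating⇒invariant-constant f f-inv {T} (dominating , connected) x y =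
    let a , a∈T , fa≡fx = meets x
        b , b∈T , fb≡fy = meets y
    in trans (sym fa≡fx) (trans (walk-preserves f f-inv (connected a∈T b∈T)) fb≡fy)
    where
    meets : ∀ z → ∃ λ t → t ∈ T × f t ≡ f z
    meets z with dominating z
    ... | inj₁ z∈T = z , z∈T , refl
    ... | inj₂ z~T = let t , t∈T , z~t = find z~T in t , t∈T , sym (f-inv z~t)

  clique⇒inducesConnected : ∀ {T} → (∀ {x y} → x ∈ T → y ∈ T → x ≡ y ⊎ E x y) →
                            InducesConnected T
  clique⇒inducesConnected clique x∈T y∈T with clique x∈T y∈T
  ... | inj₁ refl = here x∈T
  ... | inj₂ x~y  = step x∈T x~y (here y∈T)

  walk-source∈ : ∀ {T x y} → WalkIn T x y → x ∈ T
  walk-source∈ (here x∈T)     = x∈T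
  walk-source∈ (step x∈T _ _) = x∈T

  walkInPair⇒adjacent : (∀ x → ¬ E x x) → ∀ {x y} → x ≢ y → WalkIn (x ∷ y ∷ []) x y → E x y
  walkInPair⇒adjacent irrefl x≢y (here _)         = ⊥-elim (x≢y refl)
  walkInPair⇒adjacent irrefl x≢y (step _ x~z walk) with walk-source∈ walk
  ... | here refl         = ⊥-elim (irrefl _ x~z)
  ... | there (here refl) = x~z

  -- The vertex of T dominating z i, read as a position in T, is injective in i.
  disjointNeighbourhoods⇒≤ : ∀ {k} (z : Fin k → V) → (∀ {i j t} → E (z i) t → E (z j) t → i ≡ j) →
                             ∀ {T} → IsTotalDominating T → k ≤ length T
  disjointNeighbourhoods⇒≤ z disjoint {T} dominating = injective⇒≤ λ {i} {j} same →
    disjoint (lookup-index (dominating (z i)))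
             (subst (E (z j) ∘ lookup T) (sym same) (lookup-index (dominating (z j))))

module BlowUpOfKₚ⊗Kₚ
  {V : Set} (E : V → V → Set) (p : ℕ) (r₁ r₂ : V → ℕ)
  (adjacent⇔ : ∀ {x y} → E x y ⇔ (r₁ x ≢ r₁ y × r₂ x ≢ r₂ y))
  (r₁<p : ∀ x → r₁ x < p) (r₂<p : ∀ x → r₂ x < p)
  (vertex : ∀ {i j} → i < p → j < p → ∃ λ z → r₁ z ≡ i × r₂ z ≡ j)
  where
  open Graph V E

  adjacent : ∀ {x y} → r₁ x ≢ r₁ y → r₂ x ≢ r₂ y → E x y
  adjacent r₁≢ r₂≢ = from adjacent⇔ (r₁≢ , r₂≢)

  irreflexive : ∀ x → ¬ E x x
  irreflexive x x~x = proj₁ (to adjacent⇔ x~x) refl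

  mix : V → V → V
  mix x y = proj₁ (vertex (r₁<p x) (r₂<p y))

  r₁-mix : ∀ x y → r₁ (mix x y) ≡ r₁ x
  r₁-mix x y = proj₁ (proj₂ (vertex (r₁<p x) (r₂<p y)))

  r₂-mix : ∀ x y → r₂ (mix x y) ≡ r₂ y
  r₂-mix x y = proj₂ (proj₂ (vertex (r₁<p x) (r₂<p y)))

  mix-≁ˡ : ∀ x y → ¬ E (mix x y) x
  mix-≁ˡ x y e = proj₁ (to adjacent⇔ e) (r₁-mix x y)

  mix-≁ʳ : ∀ x y → ¬ E (mix x y) y
  mix-≁ʳ x y e = proj₂ (to adjacent⇔ e) (r₂-mix x y)

  module _ (0<p : 0 < p) where

    totalDominating⇒3≤ : ∀ T → IsTotalDominating T → 3 ≤ length T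
    totalDominating⇒3≤ [] dominating with dominating (proj₁ (vertex 0<p 0<p))
    ... | ()
    totalDominating⇒3≤ (x ∷ []) dominating with dominating x
    ... | here x~x = ⊥-elim (irreflexive x x~x)
    totalDominating⇒3≤ (x ∷ y ∷ []) dominating with dominating (mix x y)
    ... | here e         = ⊥-elim (mix-≁ˡ x y e)
    ... | there (here e) = ⊥-elim (mix-≁ʳ x y e)
    totalDominating⇒3≤ (_ ∷ _ ∷ _ ∷ _) _ = s≤s (s≤s (s≤s z≤n))

  module _ (1<p : 1 < p) where

    anotherResidue : ∀ a → ∃ λ b → b < p × b ≢ a
    anotherResidue zero    = 1 , 1<p , λ ()
    anotherResidue (suc _) = 0 , <-trans z<s 1<p , λ ()

    connectedDominating⇒3≤ : ∀ T → Unique T → IsConnectedDominating T → 3 ≤ length T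
    connectedDominating⇒3≤ [] _ (dominating , _) with dominating (proj₁ (vertex 1<p 1<p))
    ... | inj₁ ()
    ... | inj₂ ()
    connectedDominating⇒3≤ (x ∷ []) _ (dominating , _) with anotherResidue (r₁ x)
    ... | b , b<p , b≢r₁x with vertex b<p (r₂<p x)
    ... | z , r₁z≡b , r₂z≡r₂x with dominating z
    ... | inj₁ (here z≡x) = ⊥-elim (b≢r₁x (trans (sym r₁z≡b) (cong r₁ z≡x)))
    ... | inj₂ (here z~x) = ⊥-elim (proj₂ (to adjacent⇔ z~x) r₂z≡r₂x)
    connectedDominating⇒3≤ (x ∷ y ∷ []) ((x≢y ∷ []) ∷ _) (dominating , connected)
      with to adjacent⇔ (walkInPair⇒adjacent E irreflexive x≢y (connected (here refl) (there (here refl))))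
    ... | r₁x≢r₁y , r₂x≢r₂y with dominating (mix x y)
    ... | inj₁ (here m≡x)         = ⊥-elim (r₂x≢r₂y (trans (cong r₂ (sym m≡x)) (r₂-mix x y)))
    ... | inj₁ (there (here m≡y)) = ⊥-elim (r₁x≢r₁y (trans (sym (r₁-mix x y)) (cong r₁ m≡y)))
    ... | inj₂ (here e)           = ⊥-elim (mix-≁ˡ x y e)
    ... | inj₂ (there (here e))   = ⊥-elim (mix-≁ʳ x y e)
    connectedDominating⇒3≤ (_ ∷ _ ∷ _ ∷ _) _ _ = s≤s (s≤s (s≤s z≤n))

  module _ (2<p : 2 < p) where

    avoidingBoth : ∀ a b → ∃ λ (i : Fin 3) → a ≢ toℕ i × b ≢ toℕ i
    avoidingBoth 0             0             = # 1 , (λ ()) , (λ ())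
    avoidingBoth 0             1             = # 2 , (λ ()) , (λ ())
    avoidingBoth 0             (suc (suc _)) = # 1 , (λ ()) , (λ ())
    avoidingBoth 1             0             = # 2 , (λ ()) , (λ ())
    avoidingBoth 1             (suc _)       = # 0 , (λ ()) , (λ ())
    avoidingBoth (suc (suc _)) 0             = # 1 , (λ ()) , (λ ())
    avoidingBoth (suc (suc _)) (suc _)       = # 0 , (λ ()) , (λ ())

    diagonalWithResidues : ∀ i → ∃ λ z → r₁ z ≡ toℕ i × r₂ z ≡ toℕ i
    diagonalWithResidues i = vertex i<p i<p
      where
      i<p : toℕ i < p
      i<p = <-≤-trans (toℕ<n i) 2<p

    diagonal : Fin 3 → V
    diagonal = proj₁ ∘ diagonalWithResidues

    r₁-diagonal : ∀ i → r₁ (diagonal i) ≡ toℕ i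
    r₁-diagonal = proj₁ ∘ proj₂ ∘ diagonalWithResidues

    r₂-diagonal : ∀ i → r₂ (diagonal i) ≡ toℕ i
    r₂-diagonal = proj₂ ∘ proj₂ ∘ diagonalWithResidues

    adjacent-diagonal : ∀ {x} i → r₁ x ≢ toℕ i → r₂ x ≢ toℕ i → E x (diagonal i)
    adjacent-diagonal i r₁≢ r₂≢ =
      adjacent (λ e → r₁≢ (trans e (r₁-diagonal i))) (λ e → r₂≢ (trans e (r₂-diagonal i)))

    diagonals : List V
    diagonals = tabulate diagonal

    diagonals-unique : Unique diagonals
    diagonals-unique = tabulate⁺ λ {i} {j} e →
      toℕ-injective (trans (sym (r₁-diagonal i)) (trans (cong r₁ e) (r₁-diagonal j)))

    diagonals-totalDominating : IsTotalDominating diagonals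
    diagonals-totalDominating x =
      let i , r₁≢ , r₂≢ = avoidingBoth (r₁ x) (r₂ x)
      in lose (∈-tabulate⁺ {f = diagonal} i) (adjacent-diagonal i r₁≢ r₂≢)

    diagonals-clique : ∀ {x y} → x ∈ diagonals → y ∈ diagonals → x ≡ y ⊎ E x y
    diagonals-clique x∈ y∈ with ∈-tabulate⁻ {f = diagonal} x∈ | ∈-tabulate⁻ {f = diagonal} y∈
    ... | i , refl | j , refl with i ≟ᶠ j
    ... | yes refl = inj₁ refl
    ... | no i≢j   = inj₂ (adjacent-diagonal j (i≢j ∘ toℕ-injective ∘ trans (sym (r₁-diagonal i)))
                                               (i≢j ∘ toℕ-injective ∘ trans (sym (r₂-diagonal i))))

    totalDominationNumberIs3 : TotalDominationNumberIs 3
    totalDominationNumberIs3 =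
      (diagonals , diagonals-unique , diagonals-totalDominating , refl) ,
      λ T _ → totalDominating⇒3≤ (<-trans z<s 2<p) T

    connectedDominationNumberIs3 : ConnectedDominationNumberIs 3
    connectedDominationNumberIs3 =
      (diagonals , diagonals-unique ,
        (inj₂ ∘ diagonals-totalDominating , clique⇒inducesConnected E diagonals-clique) , refl) ,
      connectedDominating⇒3≤ (<-trans (s<s z<s) 2<p)

  module _ (p≡2 : p ≡ 2) where

    r₁<2 : ∀ x → r₁ x < 2
    r₁<2 x = subst (r₁ x <_) p≡2 (r₁<p x)

    r₂<2 : ∀ x → r₂ x < 2
    r₂<2 x = subst (r₂ x <_) p≡2 (r₂<p x)

    commonNeighbour⇒sameResidues : ∀ {x y t} → E x t → E y t → r₁ x ≡ r₁ y × r₂ x ≡ r₂ y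
    commonNeighbour⇒sameResidues {x} {y} {t} x~t y~t =
      let r₁x≢ , r₂x≢ = to adjacent⇔ x~t
          r₁y≢ , r₂y≢ = to adjacent⇔ y~t
      in trans (≢⇒≡1∸ (r₁<2 x) (r₁<2 t) r₁x≢) (sym (≢⇒≡1∸ (r₁<2 y) (r₁<2 t) r₁y≢)) ,
         trans (≢⇒≡1∸ (r₂<2 x) (r₂<2 t) r₂x≢) (sym (≢⇒≡1∸ (r₂<2 y) (r₂<2 t) r₂y≢))

    onDiagonal : V → Bool
    onDiagonal x = r₁ x ≡ᵇ r₂ x

    adjacent-preserves-onDiagonal : ∀ {x y} → E x y → onDiagonal x ≡ onDiagonal y
    adjacent-preserves-onDiagonal {x} {y} x~y =
      let r₁≢ , r₂≢ = to adjacent⇔ x~y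
      in sym (trans (cong₂ _≡ᵇ_ (≢⇒≡1∸ (r₁<2 y) (r₁<2 x) (r₁≢ ∘ sym))
                                (≢⇒≡1∸ (r₂<2 y) (r₂<2 x) (r₂≢ ∘ sym)))
                    (≡ᵇ-1∸ (r₁<2 x) (r₂<2 x)))

    <2⇒<p : ∀ {i} → i < 2 → i < p
    <2⇒<p = subst (_ <_) (sym p≡2)

    cornerWithResidues : ∀ i → ∃ λ z → r₁ z ≡ toℕ i / 2 × r₂ z ≡ toℕ i % 2
    cornerWithResidues i = vertex (<2⇒<p (m<n*o⇒m/o<n {n = 2} (toℕ<n i))) (<2⇒<p (m%n<n (toℕ i) 2))

    corner : Fin 4 → V
    corner = proj₁ ∘ cornerWithResidues

    r₁-corner : ∀ i → r₁ (corner i) ≡ toℕ i / 2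
    r₁-corner = proj₁ ∘ proj₂ ∘ cornerWithResidues

    r₂-corner : ∀ i → r₂ (corner i) ≡ toℕ i % 2
    r₂-corner = proj₂ ∘ proj₂ ∘ cornerWithResidues

    corner-injective : ∀ {i j} → r₁ (corner i) ≡ r₁ (corner j) → r₂ (corner i) ≡ r₂ (corner j) → i ≡ j
    corner-injective {i} {j} r₁≡ r₂≡ = toℕ-injective (/∧%⇒≡ 2
      (trans (sym (r₁-corner i)) (trans r₁≡ (r₁-corner j)))
      (trans (sym (r₂-corner i)) (trans r₂≡ (r₂-corner j))))

    oppositeCorner : ∀ {a b} → a < 2 → b < 2 → ∃ λ (i : Fin 4) → a ≢ toℕ i / 2 × b ≢ toℕ i % 2
    oppositeCorner {0}           {0}           _              _              = # 3 , (λ ()) , (λ ())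
    oppositeCorner {0}           {1}           _              _              = # 2 , (λ ()) , (λ ())
    oppositeCorner {1}           {0}           _              _              = # 1 , (λ ()) , (λ ())
    oppositeCorner {1}           {1}           _              _              = # 0 , (λ ()) , (λ ())
    oppositeCorner {suc (suc _)} {_}           (s≤s (s≤s ())) _
    oppositeCorner {_}           {suc (suc _)} _              (s≤s (s≤s ()))

    corners : List V
    corners = tabulate corner

    corners-unique : Unique corners
    corners-unique = tabulate⁺ λ e → corner-injective (cong r₁ e) (cong r₂ e)

    corners-totalDominating : IsTotalDominating corners
    corners-totalDominating x =
      let i , r₁≢ , r₂≢ = oppositeCorner (r₁<2 x) (r₂<2 x)
      in lose (∈-tabulate⁺ {f = corner} i)
              (adjacent (λ e → r₁≢ (trans e (r₁-corner i))) (λ e → r₂≢ (trans e (r₂-corner i))))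

    totalDominationNumberIs4 : TotalDominationNumberIs 4
    totalDominationNumberIs4 =
      (corners , corners-unique , corners-totalDominating , refl) ,
      λ T _ → disjointNeighbourhoods⇒≤ E corner
                (λ i~t j~t → uncurry corner-injective (commonNeighbour⇒sameResidues i~t j~t))

    onDiagonal-corner : ∀ i → onDiagonal (corner i) ≡ (toℕ i / 2 ≡ᵇ toℕ i % 2)
    onDiagonal-corner i = cong₂ _≡ᵇ_ (r₁-corner i) (r₂-corner i)

    ¬connectedDominating : ∀ T → ¬ IsConnectedDominating T
    ¬connectedDominating _ cd with
      trans (sym (onDiagonal-corner (# 0)))
        (trans (connectedDominating⇒invariant-constant E onDiagonal adjacent-preserves-onDiagonal cd
                  (corner (# 0)) (corner (# 1)))
               (onDiagonal-corner (# 1)))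
    ... | ()

module CayleyGraph (p α : ℕ) (p-prime : Prime p) (α≥1 : α ≥ 1) where

  private instance
    p≢0 : NonZero p
    p≢0 = prime⇒nonZero p-prime

  r₁ r₂ : Vtx p (p ^ α) → ℕ
  r₁ (u , _) = toℕ u % p
  r₂ (_ , v) = toℕ v % p

  adjacent⇔ : ∀ {x y} → Adj p (p ^ α) x y ⇔ (r₁ x ≢ r₁ y × r₂ x ≢ r₂ y)
  adjacent⇔ {u , v} {u' , v'} =
    inPhi-diffMod⇔ p-prime {k = 1} ∣-refl (m∣m*n 1) u u' ×-⇔
    inPhi-diffMod⇔ p-prime {k = α} (m∣m^n α≥1) ∣-refl v v'

  vertex : ∀ {i j} → i < p → j < p → ∃ λ z → r₁ z ≡ i × r₂ z ≡ j
  vertex i<p j<p = (fromℕ< i<p , fromℕ< j<p^α) , residue i<p i<p , residue j<p^α j<p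
    where
    j<p^α : _ < p ^ α
    j<p^α = <-≤-trans j<p (∣⇒≤ {{m^n≢0 p α}} (m∣m^n α≥1))
    residue : ∀ {i n} (i<n : i < n) → i < p → toℕ (fromℕ< i<n) % p ≡ i
    residue i<n i<p = trans (cong (_% p) (toℕ-fromℕ< i<n)) (m<n⇒m%n≡m i<p)

  open BlowUpOfKₚ⊗Kₚ (Adj p (p ^ α)) p r₁ r₂ adjacent⇔ (λ _ → m%n<n _ p) (λ _ → m%n<n _ p) vertex public

theorem2p2 : (p α : ℕ) → Prime p → α ≥ 1 →
    (p ≡ 2 →
      Graph.TotalDominationNumberIs (Vtx p (p ^ α)) (Adj p (p ^ α)) 4
      × (∀ (T : List (Vtx p (p ^ α))) →
           Graph.IsConnectedDominating (Vtx p (p ^ α)) (Adj p (p ^ α)) T → ⊥))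
    × (p ≥ 3 →
      Graph.TotalDominationNumberIs (Vtx p (p ^ α)) (Adj p (p ^ α)) 3
      × Graph.ConnectedDominationNumberIs (Vtx p (p ^ α)) (Adj p (p ^ α)) 3)
theorem2p2 p α p-prime α≥1 =
  (λ p≡2 → totalDominationNumberIs4 p≡2 , ¬connectedDominating p≡2) ,
  (λ p≥3 → totalDominationNumberIs3 p≥3 , connectedDominationNumberIs3 p≥3)
  where open CayleyGraph p α p-prime α≥1
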